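{- Let $a_1,b_1,a_2,b_2$ be complex numbers, $p_2,q_1,q_2$ non-negative integers, and $l$ an integer with $0\le l\le p_2+q_1+q_2$. Then $$S_{a_1,b_1}^{a_2,b_2,q_1+q_2}(p_2,l)=\sum_{m=0}^{p_2+q_2}S_{a_1,b_1}^{a_2,b_2,q_2}(p_2,m)\,S_{a_2,a_2m+b_2}(q_1,l-m).$$
   Context: For complex numbers $a_1,b_1,a_2,b_2$, non-negative integers $p_1,p_2$ and a non-negative integer $k$, the generalized Stirling number of the second kind is $$S_{a_1,b_1}^{a_2,b_2,p_2}(p_1,k)=\frac{1}{k!}\sum_{j=0}^{k}(-1)^j\binom{k}{j}\bigl(a_1(k-j)+b_1\bigr)^{p_1}\bigl(a_2(k-j)+b_2\bigr)^{p_2},$$ with $0^0=1$, and it is set to $0$ for negative $k$. The one-parameter version is $S_{a,b}(q,k)=\frac{1}{k!}\sum_{j=0}^{k}(-1)^j\binom kj(a(k-j)+b)^q$ for $k\ge0$ and $S_{a,b}(q,k)=0$ for $k<0$ (these are the numbers with $(an+b)^q=\sum_{k}k!S_{a,b}(q,k)\binom nk$; they vanish for $k>q$). -}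

module Defs where

open import Level using (Level)
open import Algebra.Bundles using (CommutativeRing)
open import Data.Nat using (ℕ; zero; suc; _∸_)
open import Data.Nat.Combinatorics using (_C_)
open import Data.Integer using (ℤ; +_; -[1+_])

module _ {c ℓ : Level} (R : CommutativeRing c ℓ) where
  open CommutativeRing R hiding (zero)

  ι : ℕ → Carrier
  ι zero    = 0#
  ι (suc n) = 1# + ι n

  pow : Carrier → ℕ → Carrier
  pow x zero    = 1#
  pow x (suc n) = x * pow x n

  sumTo : ℕ → (ℕ → Carrier) → Carrier
  sumTo zero    f = f zero
  sumTo (suc k) f = sumTo k f + f (suc k)

  -- R is a ℚ-algebra: every positive integer is invertible in R
  -- (inv n is the inverse of n+1).  ℂ is such a ring.
  record RationalAlgebra : Set (c Level.⊔ ℓ) where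
    field
      inv       : ℕ → Carrier
      inv-right : ∀ n → ι (suc n) * inv n ≈ 1#

  module _ (Q : RationalAlgebra) where
    open RationalAlgebra Q

    invFact : ℕ → Carrier
    invFact zero    = 1#
    invFact (suc k) = inv k * invFact k

    -- S_{a1,b1}^{a2,b2,p2}(p1,k), zero for negative k
    S2 : (a₁ b₁ a₂ b₂ : Carrier) (p₂ p₁ : ℕ) → ℤ → Carrier
    S2 a₁ b₁ a₂ b₂ p₂ p₁ (+ k) =
      invFact k * sumTo k (λ j →
        pow (- 1#) j * ι (k C j)
          * pow (a₁ * ι (k ∸ j) + b₁) p₁
          * pow (a₂ * ι (k ∸ j) + b₂) p₂)
    S2 a₁ b₁ a₂ b₂ p₂ p₁ -[1+ k ] = 0#

    S1 : (a b : Carrier) (q : ℕ) → ℤ → Carrier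
    S1 a b q (+ k) =
      invFact k * sumTo k (λ j →
        pow (- 1#) j * ι (k C j) * pow (a * ι (k ∸ j) + b) q)
    S1 a b q -[1+ k ] = 0#

-- With Δf(y) = f(y+1) − f(y), the defining sums say that k!·S_{a₁,b₁}^{a₂,b₂,p}(p′,k) is
-- Δᵏ[(a₁y+b₁)^{p′}(a₂y+b₂)^{p}](0) and k!·S_{a,b}(q,k) is Δᵏ[(ay+b)^q](0).  Split
-- (a₁y+b₁)^{p₂}(a₂y+b₂)^{q₁+q₂} = g(y)h(y) with g = (a₁y+b₁)^{p₂}(a₂y+b₂)^{q₂}, h = (a₂y+b₂)^{q₁}.
-- The Leibniz rule Δˡ(gh)(0) = Σₘ C(l,m) Δᵐg(0) Δˡ⁻ᵐh(m), divided by l!, is the identity term by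
-- term, since h(y+m) = (a₂y + a₂m+b₂)^{q₁}.  Terms with m > l vanish because S is zero at negative
-- arguments, and terms with m > p₂+q₂ because g is a polynomial of degree p₂+q₂.
module Submission where

open import Defs
open import Level using (Level)
open import Algebra.Bundles using (CommutativeRing)
open import Data.Nat using (ℕ)
import Data.Nat as ℕ
open import Data.Integer using (ℤ; +_; _-_; _≤_)

open import Data.Nat using (zero; suc; _∸_; _!; z≤n; s≤s)
import Data.Nat.Properties as ℕₚ
import Data.Integer.Properties as ℤₚ
open import Data.Nat.Combinatorics
  using (_C_; nCk+nC[k+1]≡[n+1]C[k+1]; k>n⇒nCk≡0; nCk≡n!/k![n-k]!; k![n∸k]!∣n!)
open import Data.Nat.DivMod using (m*[n/m]≡n)
open import Data.Sum using (inj₁; inj₂)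
open import Relation.Nullary using (yes; no)
import Relation.Binary.PropositionalEquality as ≡

k![n∸k]!nCk≡n! : ∀ {n k} → k ℕ.≤ n → (k ! ℕ.* (n ∸ k) !) ℕ.* (n C k) ≡.≡ n !
k![n∸k]!nCk≡n! {n} {k} k≤n = ≡.trans (≡.cong ((k ! ℕ.* (n ∸ k) !) ℕ.*_) (nCk≡n!/k![n-k]! k≤n))
                                     (m*[n/m]≡n {{ℕₚ._!*_!≢0 k (n ∸ k)}} (k![n∸k]!∣n! k≤n))

module _ {c ℓ : Level} (R : CommutativeRing c ℓ) where
  open CommutativeRing R hiding (zero; _-_)
  open import Algebra.Properties.Ring ring using (-‿distribˡ-*; -‿distribʳ-*; -1*x≈-x; x[y-z]≈xy-xz; [y-z]x≈yx-zx)
  open import Algebra.Properties.AbelianGroup +-abelianGroup using (⁻¹-∙-comm; //-rightDividesʳ)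
  open import Relation.Binary.Reasoning.Setoid setoid
  open import Algebra.Solver.Ring.NaturalCoefficients.Default commutativeSemiring

  ι-+ : ∀ m n → ι R (m ℕ.+ n) ≈ ι R m + ι R n
  ι-+ zero    n = sym (+-identityˡ _)
  ι-+ (suc m) n = trans (+-congˡ (ι-+ m n)) (sym (+-assoc _ _ _))

  ι-* : ∀ m n → ι R (m ℕ.* n) ≈ ι R m * ι R n
  ι-* zero    n = sym (zeroˡ _)
  ι-* (suc m) n = begin
    ι R (n ℕ.+ m ℕ.* n)         ≈⟨ ι-+ n (m ℕ.* n) ⟩
    ι R n + ι R (m ℕ.* n)       ≈⟨ +-cong (sym (*-identityˡ _)) (ι-* m n) ⟩
    1# * ι R n + ι R m * ι R n  ≈⟨ distribʳ _ _ _ ⟨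
    (1# + ι R m) * ι R n        ∎

  ι-1 : ι R 1 ≈ 1#
  ι-1 = +-identityʳ 1#

  pow-+ : ∀ x m n → pow R x (m ℕ.+ n) ≈ pow R x m * pow R x n
  pow-+ x zero    n = sym (*-identityˡ _)
  pow-+ x (suc m) n = trans (*-congˡ (pow-+ x m n)) (sym (*-assoc _ _ _))

  pow-cong : ∀ {x y} n → x ≈ y → pow R x n ≈ pow R y n
  pow-cong zero    x≈y = refl
  pow-cong (suc n) x≈y = *-cong x≈y (pow-cong n x≈y)

  +-‿telescope : ∀ x y z → (x + - y) + (y + - z) ≈ x + - z
  +-‿telescope x y z = begin
    (x + - y) + (y + - z)  ≈⟨ regroup x (- y) y (- z) ⟩
    (x + - z) + (y + - y)  ≈⟨ +-congˡ (-‿inverseʳ y) ⟩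
    (x + - z) + 0#         ≈⟨ +-identityʳ _ ⟩
    x + - z                ∎
    where
    regroup : ∀ x y′ y z′ → (x + y′) + (y + z′) ≈ (x + z′) + (y + y′)
    regroup = solve 4 (λ x y′ y z′ → (x :+ y′) :+ (y :+ z′) := (x :+ z′) :+ (y :+ y′)) refl

  *-difference : ∀ x′ y′ x y → x′ * y′ + - (x * y) ≈ (x′ + - x) * y′ + x * (y′ + - y)
  *-difference x′ y′ x y = sym (begin
    (x′ + - x) * y′ + x * (y′ + - y)               ≈⟨ +-cong ([y-z]x≈yx-zx y′ x′ x) (x[y-z]≈xy-xz x y′ y) ⟩
    (x′ * y′ + - (x * y′)) + (x * y′ + - (x * y))  ≈⟨ +-‿telescope _ _ _ ⟩
    x′ * y′ + - (x * y)                            ∎)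

  sumTo-cong : ∀ n {F G : ℕ → Carrier} → (∀ k → k ℕ.≤ n → F k ≈ G k) → sumTo R n F ≈ sumTo R n G
  sumTo-cong zero    F≈G = F≈G 0 z≤n
  sumTo-cong (suc n) F≈G = +-cong (sumTo-cong n (λ k k≤n → F≈G k (ℕₚ.m≤n⇒m≤1+n k≤n))) (F≈G (suc n) ℕₚ.≤-refl)

  sumTo-+ : ∀ n (F G : ℕ → Carrier) → sumTo R n (λ k → F k + G k) ≈ sumTo R n F + sumTo R n G
  sumTo-+ zero    F G = refl
  sumTo-+ (suc n) F G = trans (+-congʳ (sumTo-+ n F G)) (interchange _ _ _ _)
    where
    interchange : ∀ x y z w → (x + y) + (z + w) ≈ (x + z) + (y + w)
    interchange = solve 4 (λ x y z w → (x :+ y) :+ (z :+ w) := (x :+ z) :+ (y :+ w)) refl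

  *-distribˡ-sumTo : ∀ n x (F : ℕ → Carrier) → x * sumTo R n F ≈ sumTo R n (λ k → x * F k)
  *-distribˡ-sumTo zero    x F = refl
  *-distribˡ-sumTo (suc n) x F = trans (distribˡ _ _ _) (+-congʳ (*-distribˡ-sumTo n x F))

  -‿distrib-sumTo : ∀ n (F : ℕ → Carrier) → - sumTo R n F ≈ sumTo R n (λ k → - F k)
  -‿distrib-sumTo zero    F = refl
  -‿distrib-sumTo (suc n) F = trans (sym (⁻¹-∙-comm _ _)) (+-congʳ (-‿distrib-sumTo n F))

  sumTo-suc : ∀ n (F : ℕ → Carrier) → sumTo R (suc n) F ≈ F 0 + sumTo R n (λ k → F (suc k))
  sumTo-suc zero    F = refl
  sumTo-suc (suc n) F = trans (+-congʳ (sumTo-suc n F)) (+-assoc _ _ _)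

  sumTo-zero : ∀ n (F : ℕ → Carrier) → (∀ k → k ℕ.≤ n → F k ≈ 0#) → sumTo R n F ≈ 0#
  sumTo-zero zero    F F≈0 = F≈0 0 z≤n
  sumTo-zero (suc n) F F≈0 =
    trans (+-cong (sumTo-zero n F (λ k k≤n → F≈0 k (ℕₚ.m≤n⇒m≤1+n k≤n))) (F≈0 (suc n) ℕₚ.≤-refl)) (+-identityʳ 0#)

  sumTo-extend : ∀ {N M} (F : ℕ → Carrier) → N ℕ.≤ M → (∀ k → N ℕ.< k → F k ≈ 0#) →
                 sumTo R N F ≈ sumTo R M F
  sumTo-extend {M = zero}  F z≤n      F≈0 = refl
  sumTo-extend {N} {suc M} F N≤1+M F≈0 with ℕₚ.m≤n⇒m<n∨m≡n N≤1+M
  ... | inj₂ ≡.refl    = refl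
  ... | inj₁ (s≤s N≤M) = begin
    sumTo R N F       ≈⟨ sumTo-extend F N≤M F≈0 ⟩
    sumTo R M F       ≈⟨ +-identityʳ _ ⟨
    sumTo R M F + 0#  ≈⟨ +-congˡ (F≈0 (suc M) (s≤s N≤M)) ⟨
    sumTo R (suc M) F ∎

  sumTo-pascal : ∀ n (T : ℕ → Carrier) →
    sumTo R (suc n) (λ k → ι R (suc n C k) * T k) ≈
      sumTo R n (λ k → ι R (n C k) * T (suc k)) + sumTo R n (λ k → ι R (n C k) * T k)
  sumTo-pascal n T = begin
    sumTo R (suc n) (λ k → ι R (suc n C k) * T k)  ≈⟨ sumTo-suc n _ ⟩
    ι R 1 * T 0 + sumTo R n (λ k → ι R (suc n C suc k) * T (suc k))
      ≈⟨ +-congˡ (trans (sumTo-cong n (λ k _ → trans (*-congʳ (pascal k)) (distribʳ _ _ _))) (sumTo-+ n _ _)) ⟩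
    ι R 1 * T 0 + (A + B′)                         ≈⟨ swap _ _ _ ⟩
    A + (ι R 1 * T 0 + B′)                         ≈⟨ +-congˡ (sumTo-suc n _) ⟨
    A + sumTo R (suc n) (λ k → ι R (n C k) * T k)  ≈⟨ +-congˡ (sumTo-extend _ (ℕₚ.n≤1+n n) beyond-n) ⟨
    A + B                                          ∎
    where
    A B B′ : Carrier
    A  = sumTo R n (λ k → ι R (n C k) * T (suc k))
    B  = sumTo R n (λ k → ι R (n C k) * T k)
    B′ = sumTo R n (λ k → ι R (n C suc k) * T (suc k))
    pascal : ∀ k → ι R (suc n C suc k) ≈ ι R (n C k) + ι R (n C suc k)
    pascal k = trans (reflexive (≡.cong (ι R) (≡.sym (nCk+nC[k+1]≡[n+1]C[k+1] n k)))) (ι-+ (n C k) (n C suc k))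
    swap : ∀ x y z → x + (y + z) ≈ y + (x + z)
    swap = solve 3 (λ x y z → x :+ (y :+ z) := y :+ (x :+ z)) refl
    beyond-n : ∀ k → n ℕ.< k → ι R (n C k) * T k ≈ 0#
    beyond-n k n<k = trans (*-congʳ (reflexive (≡.cong (ι R) (k>n⇒nCk≡0 n<k)))) (zeroˡ _)

  Δ : (ℕ → Carrier) → ℕ → Carrier
  Δ f x = f (suc x) + - f x

  Δ[_] : ℕ → (ℕ → Carrier) → ℕ → Carrier
  Δ[ zero  ] f = f
  Δ[ suc k ] f = Δ (Δ[ k ] f)

  Δ[]-cong : ∀ {f g : ℕ → Carrier} → (∀ y → f y ≈ g y) → ∀ k x → Δ[ k ] f x ≈ Δ[ k ] g x
  Δ[]-cong f≈g zero    x = f≈g x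
  Δ[]-cong f≈g (suc k) x = +-cong (Δ[]-cong f≈g k (suc x)) (-‿cong (Δ[]-cong f≈g k x))

  Δ[]-translate : ∀ k (f : ℕ → Carrier) m x → Δ[ k ] (λ t → f (t ℕ.+ m)) x ≈ Δ[ k ] f (x ℕ.+ m)
  Δ[]-translate zero    f m x = refl
  Δ[]-translate (suc k) f m x = +-cong (Δ[]-translate k f m (suc x)) (-‿cong (Δ[]-translate k f m x))

  private
    suc-∸ : ∀ {n k} → k ℕ.≤ n → suc n ∸ k ≡.≡ suc (n ∸ k)
    suc-∸ k≤n = ℕₚ.+-∸-assoc 1 k≤n

  Δ[]-expansion : ∀ n (f : ℕ → Carrier) x →
    Δ[ n ] f x ≈ sumTo R n (λ k → ι R (n C k) * (pow R (- 1#) k * f (x ℕ.+ (n ∸ k))))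
  Δ[]-expansion zero f x = sym (begin
    ι R 1 * (1# * f (x ℕ.+ 0))  ≈⟨ *-congʳ ι-1 ⟩
    1# * (1# * f (x ℕ.+ 0))     ≈⟨ trans (*-identityˡ _) (*-identityˡ _) ⟩
    f (x ℕ.+ 0)                 ≈⟨ reflexive (≡.cong f (ℕₚ.+-identityʳ x)) ⟩
    f x                         ∎)
  Δ[]-expansion (suc n) f x = begin
    Δ[ n ] f (suc x) + - Δ[ n ] f x
      ≈⟨ +-cong (Δ[]-expansion n f (suc x)) (-‿cong (Δ[]-expansion n f x)) ⟩
    sumTo R n (λ k → ι R (n C k) * (pow R (- 1#) k * f (suc x ℕ.+ (n ∸ k))))
      + - sumTo R n (λ k → ι R (n C k) * (pow R (- 1#) k * f (x ℕ.+ (n ∸ k))))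
      ≈⟨ +-cong (sumTo-cong n (λ k k≤n → *-congˡ (*-congˡ (reflexive (≡.cong f (shift k≤n))))))
                (trans (-‿distrib-sumTo n _) (sumTo-cong n (λ k _ → negate-sign _ _ _))) ⟩
    sumTo R n (λ k → ι R (n C k) * T k) + sumTo R n (λ k → ι R (n C k) * T (suc k))
      ≈⟨ +-comm _ _ ⟩
    sumTo R n (λ k → ι R (n C k) * T (suc k)) + sumTo R n (λ k → ι R (n C k) * T k)
      ≈⟨ sumTo-pascal n T ⟨
    sumTo R (suc n) (λ k → ι R (suc n C k) * T k) ∎
    where
    T : ℕ → Carrier
    T k = pow R (- 1#) k * f (x ℕ.+ (suc n ∸ k))
    shift : ∀ {k} → k ℕ.≤ n → suc x ℕ.+ (n ∸ k) ≡.≡ x ℕ.+ (suc n ∸ k)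
    shift k≤n = ≡.trans (≡.sym (ℕₚ.+-suc x _)) (≡.cong (x ℕ.+_) (≡.sym (suc-∸ k≤n)))
    negate-sign : ∀ b s y → - (b * (s * y)) ≈ b * ((- 1# * s) * y)
    negate-sign b s y = begin
      - (b * (s * y))       ≈⟨ -‿distribʳ-* b _ ⟩
      b * - (s * y)         ≈⟨ *-congˡ (-‿distribˡ-* s y) ⟩
      b * (- s * y)         ≈⟨ *-congˡ (*-congʳ (-1*x≈-x s)) ⟨
      b * ((- 1# * s) * y)  ∎

  Δ[]-leibniz : ∀ n (f g : ℕ → Carrier) x →
    Δ[ n ] (λ y → f y * g y) x ≈ sumTo R n (λ k → ι R (n C k) * (Δ[ k ] f x * Δ[ n ∸ k ] g (x ℕ.+ k)))
  Δ[]-leibniz zero f g x = sym (begin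
    ι R 1 * (f x * g (x ℕ.+ 0))  ≈⟨ trans (*-congʳ ι-1) (*-identityˡ _) ⟩
    f x * g (x ℕ.+ 0)            ≈⟨ *-congˡ (reflexive (≡.cong g (ℕₚ.+-identityʳ x))) ⟩
    f x * g x                    ∎)
  Δ[]-leibniz (suc n) f g x = begin
    Δ[ n ] fg (suc x) + - Δ[ n ] fg x
      ≈⟨ +-cong (Δ[]-leibniz n f g (suc x)) (trans (-‿cong (Δ[]-leibniz n f g x)) (-‿distrib-sumTo n _)) ⟩
    sumTo R n U + sumTo R n (λ k → - V k)           ≈⟨ sumTo-+ n _ _ ⟨
    sumTo R n (λ k → U k + - V k)                   ≈⟨ sumTo-cong n difference ⟩
    sumTo R n (λ k → ι R (n C k) * T (suc k) + ι R (n C k) * T k)  ≈⟨ sumTo-+ n _ _ ⟩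
    sumTo R n (λ k → ι R (n C k) * T (suc k)) + sumTo R n (λ k → ι R (n C k) * T k)
      ≈⟨ sumTo-pascal n T ⟨
    sumTo R (suc n) (λ k → ι R (suc n C k) * T k)   ∎
    where
    fg T U V : ℕ → Carrier
    fg y = f y * g y
    T k = Δ[ k ] f x * Δ[ suc n ∸ k ] g (x ℕ.+ k)
    U k = ι R (n C k) * (Δ[ k ] f (suc x) * Δ[ n ∸ k ] g (suc x ℕ.+ k))
    V k = ι R (n C k) * (Δ[ k ] f x * Δ[ n ∸ k ] g (x ℕ.+ k))
    difference : ∀ k → k ℕ.≤ n → U k + - V k ≈ ι R (n C k) * T (suc k) + ι R (n C k) * T k
    difference k k≤n = begin
      U k + - V k                                          ≈⟨ +-congˡ (-‿distribʳ-* _ _) ⟩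
      ι R (n C k) * _ + ι R (n C k) * - _                  ≈⟨ distribˡ _ _ _ ⟨
      ι R (n C k) * (_ + - _)                              ≈⟨ *-congˡ (*-difference _ _ _ _) ⟩
      ι R (n C k) * (Δ[ suc k ] f x * Δ[ n ∸ k ] g (suc (x ℕ.+ k))
                      + Δ[ k ] f x * Δ[ suc (n ∸ k) ] g (x ℕ.+ k))
        ≈⟨ *-congˡ (+-cong (*-congˡ (reflexive (≡.cong (Δ[ n ∸ k ] g) (≡.sym (ℕₚ.+-suc x k)))))
                           (*-congˡ (reflexive (≡.cong (λ j → Δ[ j ] g (x ℕ.+ k)) (≡.sym (suc-∸ k≤n)))))) ⟩
      ι R (n C k) * (T (suc k) + T k)                      ≈⟨ distribˡ _ _ _ ⟩
      ι R (n C k) * T (suc k) + ι R (n C k) * T k          ∎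

  Degree≤ : ℕ → (ℕ → Carrier) → Set ℓ
  Degree≤ d f = ∀ k x → d ℕ.< k → Δ[ k ] f x ≈ 0#

  degree≤-intro : ∀ d (f : ℕ → Carrier) → (∀ x → Δ[ suc d ] f x ≈ 0#) → Degree≤ d f
  degree≤-intro d f Δ≈0 (suc k) x (s≤s d≤k) with ℕₚ.m≤n⇒m<n∨m≡n d≤k
  ... | inj₂ ≡.refl = Δ≈0 x
  ... | inj₁ d<k    =
    trans (+-cong (degree≤-intro d f Δ≈0 k (suc x) d<k) (-‿cong (degree≤-intro d f Δ≈0 k x d<k))) (-‿inverseʳ 0#)

  degree≤-mono : ∀ {d e} {f : ℕ → Carrier} → d ℕ.≤ e → Degree≤ d f → Degree≤ e f
  degree≤-mono d≤e deg k x e<k = deg k x (ℕₚ.≤-<-trans d≤e e<k)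

  degree≤-const : ∀ a → Degree≤ 0 (λ _ → a)
  degree≤-const a = degree≤-intro 0 _ (λ _ → -‿inverseʳ a)

  degree≤-affine : ∀ a b → Degree≤ 1 (λ y → a * ι R y + b)
  degree≤-affine a b = degree≤-intro 1 _ (λ x → trans (+-cong (Δ-affine (suc x)) (-‿cong (Δ-affine x))) (-‿inverseʳ a))
    where
    Δ-affine : ∀ y → Δ (λ t → a * ι R t + b) y ≈ a
    Δ-affine y = trans (+-congʳ (expand a (ι R y) b)) (//-rightDividesʳ _ a)
      where
      expand : ∀ a u b → a * (1# + u) + b ≈ a + (a * u + b)
      expand = solve 3 (λ a u b → a :* (con 1 :+ u) :+ b := a :+ (a :* u :+ b)) refl

  degree≤-* : ∀ {d e} {f g : ℕ → Carrier} → Degree≤ d f → Degree≤ e g → Degree≤ (d ℕ.+ e) (λ y → f y * g y)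
  degree≤-* {d} {e} {f} {g} deg-f deg-g = degree≤-intro (d ℕ.+ e) _ (λ x →
    trans (Δ[]-leibniz (suc (d ℕ.+ e)) f g x) (sumTo-zero (suc (d ℕ.+ e)) _ (λ k _ → term-vanishes x k)))
    where
    term-vanishes : ∀ x k → ι R (suc (d ℕ.+ e) C k) * (Δ[ k ] f x * Δ[ suc (d ℕ.+ e) ∸ k ] g (x ℕ.+ k)) ≈ 0#
    term-vanishes x k with d ℕ.<? k
    ... | yes d<k = trans (*-congˡ (trans (*-congʳ (deg-f k x d<k)) (zeroˡ _))) (zeroʳ _)
    ... | no  d≮k = trans (*-congˡ (trans (*-congˡ (deg-g _ _ e<)) (zeroʳ _))) (zeroʳ _)
      where
      e< : e ℕ.< suc (d ℕ.+ e) ∸ k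
      e< = ℕₚ.m+n≤o⇒m≤o∸n (suc e)
             (s≤s (ℕₚ.≤-trans (ℕₚ.+-monoʳ-≤ e (ℕₚ.≮⇒≥ d≮k)) (ℕₚ.≤-reflexive (ℕₚ.+-comm e d))))

  degree≤-pow : ∀ {d} {f : ℕ → Carrier} → Degree≤ d f → ∀ n → Degree≤ (n ℕ.* d) (λ y → pow R (f y) n)
  degree≤-pow deg zero    = degree≤-const 1#
  degree≤-pow deg (suc n) = degree≤-* deg (degree≤-pow deg n)

  degree≤-affine-pow : ∀ a b n → Degree≤ n (λ y → pow R (a * ι R y + b) n)
  degree≤-affine-pow a b n = degree≤-mono (ℕₚ.≤-reflexive (ℕₚ.*-identityʳ n)) (degree≤-pow (degree≤-affine a b) n)

  module _ (Q : RationalAlgebra R) where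
    open RationalAlgebra Q

    invFact-! : ∀ k → invFact R Q k * ι R (k !) ≈ 1#
    invFact-! zero    = trans (*-identityˡ _) ι-1
    invFact-! (suc k) = begin
      (inv k * invFact R Q k) * ι R (suc k ℕ.* k !)          ≈⟨ *-congˡ (ι-* (suc k) (k !)) ⟩
      (inv k * invFact R Q k) * (ι R (suc k) * ι R (k !))    ≈⟨ regroup _ _ _ _ ⟩
      (ι R (suc k) * inv k) * (invFact R Q k * ι R (k !))    ≈⟨ *-cong (inv-right k) (invFact-! k) ⟩
      1# * 1#                                                ≈⟨ *-identityˡ _ ⟩
      1#                                                     ∎
      where
      regroup : ∀ a b c d → (a * b) * (c * d) ≈ (c * a) * (b * d)
      regroup = solve 4 (λ a b c d → (a :* b) :* (c :* d) := (c :* a) :* (b :* d)) refl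

    invFact-binomial : ∀ {l m} → m ℕ.≤ l → ι R (l C m) * invFact R Q l ≈ invFact R Q m * invFact R Q (l ∸ m)
    invFact-binomial {l} {m} m≤l = begin
      ι R (l C m) * invFact R Q l
        ≈⟨ *-identityʳ _ ⟨
      (ι R (l C m) * invFact R Q l) * 1#
        ≈⟨ *-congˡ (trans (*-cong (invFact-! m) (invFact-! (l ∸ m))) (*-identityˡ 1#)) ⟨
      (ι R (l C m) * invFact R Q l) * ((invFact R Q m * ι R (m !)) * (invFact R Q (l ∸ m) * ι R ((l ∸ m) !)))
        ≈⟨ regroup _ _ _ _ _ _ ⟩
      ((ι R (m !) * ι R ((l ∸ m) !)) * ι R (l C m)) * invFact R Q l * (invFact R Q m * invFact R Q (l ∸ m))
        ≈⟨ *-congʳ (*-congʳ l!) ⟩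
      ι R (l !) * invFact R Q l * (invFact R Q m * invFact R Q (l ∸ m))
        ≈⟨ *-congʳ (trans (*-comm _ _) (invFact-! l)) ⟩
      1# * (invFact R Q m * invFact R Q (l ∸ m))
        ≈⟨ *-identityˡ _ ⟩
      invFact R Q m * invFact R Q (l ∸ m) ∎
      where
      regroup : ∀ c L a x b y → (c * L) * ((a * x) * (b * y)) ≈ ((x * y) * c) * L * (a * b)
      regroup = solve 6 (λ c L a x b y → (c :* L) :* ((a :* x) :* (b :* y)) := ((x :* y) :* c) :* L :* (a :* b)) refl
      l! : (ι R (m !) * ι R ((l ∸ m) !)) * ι R (l C m) ≈ ι R (l !)
      l! = begin
        (ι R (m !) * ι R ((l ∸ m) !)) * ι R (l C m)  ≈⟨ *-congʳ (ι-* (m !) ((l ∸ m) !)) ⟨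
        ι R (m ! ℕ.* (l ∸ m) !) * ι R (l C m)        ≈⟨ ι-* (m ! ℕ.* (l ∸ m) !) (l C m) ⟨
        ι R ((m ! ℕ.* (l ∸ m) !) ℕ.* (l C m))        ≈⟨ reflexive (≡.cong (ι R) (k![n∸k]!nCk≡n! m≤l)) ⟩
        ι R (l !)                                    ∎

    invFact-Δ[]-leibniz : ∀ l (f g : ℕ → Carrier) x →
      invFact R Q l * Δ[ l ] (λ y → f y * g y) x ≈
      sumTo R l (λ m → (invFact R Q m * Δ[ m ] f x) * (invFact R Q (l ∸ m) * Δ[ l ∸ m ] g (x ℕ.+ m)))
    invFact-Δ[]-leibniz l f g x = begin
      invFact R Q l * Δ[ l ] (λ y → f y * g y) x
        ≈⟨ *-congˡ (Δ[]-leibniz l f g x) ⟩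
      invFact R Q l * sumTo R l (λ m → ι R (l C m) * (Δ[ m ] f x * Δ[ l ∸ m ] g (x ℕ.+ m)))
        ≈⟨ *-distribˡ-sumTo l _ _ ⟩
      sumTo R l (λ m → invFact R Q l * (ι R (l C m) * (Δ[ m ] f x * Δ[ l ∸ m ] g (x ℕ.+ m))))
        ≈⟨ sumTo-cong l (λ m m≤l → trans (regroup₁ _ _ _ _)
             (trans (*-congʳ (invFact-binomial m≤l)) (regroup₂ _ _ _ _))) ⟩
      sumTo R l (λ m → (invFact R Q m * Δ[ m ] f x) * (invFact R Q (l ∸ m) * Δ[ l ∸ m ] g (x ℕ.+ m))) ∎
      where
      regroup₁ : ∀ i c x y → i * (c * (x * y)) ≈ (c * i) * (x * y)
      regroup₁ = solve 4 (λ i c x y → i :* (c :* (x :* y)) := (c :* i) :* (x :* y)) refl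
      regroup₂ : ∀ i j x y → (i * j) * (x * y) ≈ (i * x) * (j * y)
      regroup₂ = solve 4 (λ i j x y → (i :* j) :* (x :* y) := (i :* x) :* (j :* y)) refl

    S2-Δ : ∀ a₁ b₁ a₂ b₂ p₂ p₁ k → S2 R Q a₁ b₁ a₂ b₂ p₂ p₁ (+ k) ≈
             invFact R Q k * Δ[ k ] (λ y → pow R (a₁ * ι R y + b₁) p₁ * pow R (a₂ * ι R y + b₂) p₂) 0
    S2-Δ a₁ b₁ a₂ b₂ p₂ p₁ k = *-congˡ (sym (trans (Δ[]-expansion k _ 0) (sumTo-cong k (λ j _ → regroup _ _ _ _))))
      where
      regroup : ∀ c s x y → c * (s * (x * y)) ≈ ((s * c) * x) * y
      regroup = solve 4 (λ c s x y → c :* (s :* (x :* y)) := ((s :* c) :* x) :* y) refl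

    S1-Δ : ∀ a b q k → S1 R Q a b q (+ k) ≈ invFact R Q k * Δ[ k ] (λ y → pow R (a * ι R y + b) q) 0
    S1-Δ a b q k = *-congˡ (sym (trans (Δ[]-expansion k _ 0) (sumTo-cong k (λ j _ → regroup _ _ _))))
      where
      regroup : ∀ c s x → c * (s * x) ≈ (s * c) * x
      regroup = solve 3 (λ c s x → c :* (s :* x) := (s :* c) :* x) refl

    S1-translate-Δ : ∀ a b q m k →
      S1 R Q a (a * ι R m + b) q (+ k) ≈ invFact R Q k * Δ[ k ] (λ y → pow R (a * ι R y + b) q) m
    S1-translate-Δ a b q m k = trans (S1-Δ a (a * ι R m + b) q k) (*-congˡ (trans
      (Δ[]-cong (λ t → pow-cong q (translate t)) k 0) (Δ[]-translate k (λ y → pow R (a * ι R y + b) q) m 0)))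
      where
      translate : ∀ t → a * ι R t + (a * ι R m + b) ≈ a * ι R (t ℕ.+ m) + b
      translate t = trans (regroup _ _ _ _) (+-congʳ (*-congˡ (sym (ι-+ t m))))
        where
        regroup : ∀ a x y b → a * x + (a * y + b) ≈ a * (x + y) + b
        regroup = solve 4 (λ a x y b → a :* x :+ (a :* y :+ b) := a :* (x :+ y) :+ b) refl

    S2-vanishes : ∀ a₁ b₁ a₂ b₂ p₂ p₁ {k} → p₁ ℕ.+ p₂ ℕ.< k → S2 R Q a₁ b₁ a₂ b₂ p₂ p₁ (+ k) ≈ 0#
    S2-vanishes a₁ b₁ a₂ b₂ p₂ p₁ {k} p<k = begin
      S2 R Q a₁ b₁ a₂ b₂ p₂ p₁ (+ k)  ≈⟨ S2-Δ a₁ b₁ a₂ b₂ p₂ p₁ k ⟩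
      invFact R Q k * _               ≈⟨ *-congˡ (degree≤-* (degree≤-affine-pow a₁ b₁ p₁) (degree≤-affine-pow a₂ b₂ p₂) k 0 p<k) ⟩
      invFact R Q k * 0#              ≈⟨ zeroʳ _ ⟩
      0#                              ∎

    S1-negative : ∀ a b q {l m} → l ℕ.< m → S1 R Q a b q (+ l - + m) ≈ 0#
    S1-negative a b q {l} {m} l<m
      rewrite ℤₚ.m-n≡m⊖n l m | ℤₚ.⊖-< l<m | ℕₚ.+-∸-assoc 1 l<m = refl

    S2-convolution : ∀ a₁ b₁ a₂ b₂ p₂ q₁ q₂ l →
      S2 R Q a₁ b₁ a₂ b₂ (q₁ ℕ.+ q₂) p₂ (+ l) ≈
      sumTo R (p₂ ℕ.+ q₂) (λ m → S2 R Q a₁ b₁ a₂ b₂ q₂ p₂ (+ m) * S1 R Q a₂ (a₂ * ι R m + b₂) q₁ (+ l - + m))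
    S2-convolution a₁ b₁ a₂ b₂ p₂ q₁ q₂ l = begin
      S2 R Q a₁ b₁ a₂ b₂ (q₁ ℕ.+ q₂) p₂ (+ l)     ≈⟨ S2-Δ a₁ b₁ a₂ b₂ (q₁ ℕ.+ q₂) p₂ l ⟩
      invFact R Q l * Δ[ l ] _ 0                  ≈⟨ *-congˡ (Δ[]-cong split-power l 0) ⟩
      invFact R Q l * Δ[ l ] (λ y → g y * h y) 0  ≈⟨ invFact-Δ[]-leibniz l g h 0 ⟩
      sumTo R l (λ m → (invFact R Q m * Δ[ m ] g 0) * (invFact R Q (l ∸ m) * Δ[ l ∸ m ] h m))
        ≈⟨ sumTo-cong l term ⟨
      sumTo R l F                                 ≈⟨ cut-at-degree ⟩
      sumTo R (p₂ ℕ.+ q₂) F                       ∎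
      where
      B g h F : ℕ → Carrier
      B y = a₂ * ι R y + b₂
      g y = pow R (a₁ * ι R y + b₁) p₂ * pow R (B y) q₂
      h y = pow R (B y) q₁
      F m = S2 R Q a₁ b₁ a₂ b₂ q₂ p₂ (+ m) * S1 R Q a₂ (B m) q₁ (+ l - + m)
      split-power : ∀ y → pow R (a₁ * ι R y + b₁) p₂ * pow R (B y) (q₁ ℕ.+ q₂) ≈ g y * h y
      split-power y = trans (*-congˡ (pow-+ (B y) q₁ q₂)) (regroup _ _ _)
        where
        regroup : ∀ x u v → x * (u * v) ≈ (x * v) * u
        regroup = solve 3 (λ x u v → x :* (u :* v) := (x :* v) :* u) refl
      term : ∀ m → m ℕ.≤ l → F m ≈ (invFact R Q m * Δ[ m ] g 0) * (invFact R Q (l ∸ m) * Δ[ l ∸ m ] h m)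
      term m m≤l = *-cong (S2-Δ a₁ b₁ a₂ b₂ q₂ p₂ m)
        (trans (reflexive (≡.cong (S1 R Q a₂ (B m) q₁) (≡.trans (ℤₚ.m-n≡m⊖n l m) (ℤₚ.⊖-≥ m≤l))))
               (S1-translate-Δ a₂ b₂ q₁ m (l ∸ m)))
      above-l : ∀ m → l ℕ.< m → F m ≈ 0#
      above-l m l<m = trans (*-congˡ (S1-negative a₂ (B m) q₁ l<m)) (zeroʳ _)
      above-degree : ∀ m → p₂ ℕ.+ q₂ ℕ.< m → F m ≈ 0#
      above-degree m deg<m = trans (*-congʳ (S2-vanishes a₁ b₁ a₂ b₂ q₂ p₂ deg<m)) (zeroˡ _)
      cut-at-degree : sumTo R l F ≈ sumTo R (p₂ ℕ.+ q₂) F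
      cut-at-degree with ℕₚ.≤-total l (p₂ ℕ.+ q₂)
      ... | inj₁ l≤deg = sumTo-extend F l≤deg above-l
      ... | inj₂ deg≤l = sym (sumTo-extend F deg≤l above-degree)

lemma4 : {c ℓ : Level} (R : CommutativeRing c ℓ) (Q : RationalAlgebra R)
         (a₁ b₁ a₂ b₂ : CommutativeRing.Carrier R) (p₂ q₁ q₂ : ℕ) (l : ℤ) →
         + 0 ≤ l → l ≤ + (p₂ ℕ.+ q₁ ℕ.+ q₂) →
         CommutativeRing._≈_ R
           (S2 R Q a₁ b₁ a₂ b₂ (q₁ ℕ.+ q₂) p₂ l)
           (sumTo R (p₂ ℕ.+ q₂) (λ m →
             CommutativeRing._*_ R
               (S2 R Q a₁ b₁ a₂ b₂ q₂ p₂ (+ m))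
               (S1 R Q a₂ (CommutativeRing._+_ R (CommutativeRing._*_ R a₂ (ι R m)) b₂) q₁ (l - + m))))
lemma4 R Q a₁ b₁ a₂ b₂ p₂ q₁ q₂ (+ l) _ _ = S2-convolution R Q a₁ b₁ a₂ b₂ p₂ q₁ q₂ l
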